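{- Let $a\ge2$, $b,c\in\mathbb{N}$. If there exist an optimal (i.e. minimum-cardinality feasible) strategy $Q$ for $(a,b,c)$-Mastermind and distinct colors $i,j\in[a]$ such that for all $y\in[b]$ and $z\in[c]$ there is $(q_1,q_2,q_3)\in Q$ with $q_1\in\{i,j\}$, $q_2\ne y$, $q_3\neq z$, then $f(a-1,b,c)\le f(a,b,c)$. The analogous statements hold for the second peg (giving $f(a,b-1,c)\le f(a,b,c)$) and for the third peg (giving $f(a,b,c-1)\le f(a,b,c)$).
   Context: $[n]=\{1,\dots,n\}$. In $(a,b,c)$-Mastermind, secrets and questions are triples in $[a]\times[b]\times[c]$ (coordinates are pegs, entries are colors). $g(s,q)$ is the number of indices $k\in[3]$ with $s_k=q_k$. A strategy is a set $Q$ of questions; it is feasible if for all distinct secrets $s,s'$ there is $q\in Q$ with $g(s,q)\neq g(s',q)$. $f(a,b,c)$ is the minimum cardinality of a feasible strategy for $(a,b,c)$-Mastermind, which equals the metric dimension of the Cartesian product $K_a\times K_b\times K_c$. For the second peg the condition reads: distinct $i,j\in[b]$ and for all $x\in[a],z\in[c]$ some question has $q_2\in\{i,j\}$, $q_1\ne x$, $q_3\ne z$; similarly for the third peg. -}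

module Defs where

open import Data.Nat using (ℕ; zero; suc; _+_; _≤_)
open import Data.Fin using (Fin; _≟_)
open import Data.Product using (_×_; _,_; ∃-syntax; Σ-syntax)
open import Data.List using (List; length)
open import Data.List.Membership.Propositional using (_∈_)
open import Data.List.Relation.Unary.Unique.Propositional using (Unique)
open import Data.Sum using (_⊎_)
open import Relation.Nullary using (¬_; yes; no)
open import Relation.Binary.PropositionalEquality using (_≡_; _≢_)

Triple : ℕ → ℕ → ℕ → Set
Triple a b c = Fin a × Fin b × Fin c

eqInd : ∀ {n} → Fin n → Fin n → ℕ
eqInd x y with x ≟ y
... | yes _ = 1
... | no _  = 0

g : ∀ {a b c} → Triple a b c → Triple a b c → ℕ
g (s₁ , s₂ , s₃) (q₁ , q₂ , q₃) = eqInd s₁ q₁ + eqInd s₂ q₂ + eqInd s₃ q₃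

-- A strategy is a finite set of questions, represented as a duplicate-free
-- list; its cardinality is the length of the list.
record Strategy (a b c : ℕ) : Set where
  constructor strategy
  field
    questions : List (Triple a b c)
    unique    : Unique questions
open Strategy public

card : ∀ {a b c} → Strategy a b c → ℕ
card Q = length (questions Q)

Feasible : ∀ {a b c} → Strategy a b c → Set
Feasible {a} {b} {c} Q =
  (s s' : Triple a b c) → s ≢ s' →
  ∃[ q ] (q ∈ questions Q × g s q ≢ g s' q)

Optimal : ∀ {a b c} → Strategy a b c → Set
Optimal {a} {b} {c} Q = Feasible Q × ((Q' : Strategy a b c) → Feasible Q' → card Q ≤ card Q')

-- f(a',b',c') ≤ card Q : some feasible strategy for (a',b',c') has at most card Q questions
FBoundedBy : ℕ → ℕ → ℕ → ℕ → Set
FBoundedBy a b c n = ∃[ Q ] (Feasible {a} {b} {c} Q × card Q ≤ n)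

{-# OPTIONS --safe #-}

-- Merge colours i and j of a peg: in every question colour j becomes i and the
-- remaining colours are renumbered, while a secret of the smaller game is read as
-- a secret of the larger one avoiding colour j (via punchIn j). Two secrets that
-- agree on that peg, or both avoid colour i there, do not see the merge, so the
-- image of any question separating them before still separates them. If exactly
-- one of them has colour i, the hypothesis yields a question with colour i or j on
-- that peg that disagrees with the other secret on the remaining two pegs: it gets
-- at least one agreement from the first secret and none from the second. The
-- second and third pegs reduce to the first by permuting pegs, which preserves g.

module Submission where

open import Defs
open import Data.Nat using (ℕ; zero; suc; _+_; _∸_; _≤_)
open import Data.Nat.Properties using (+-assoc; +-cancelˡ-≡; 1+n≢0; +-commutativeSemigroup; ≤-trans; ≤-reflexive)
open import Data.Fin using (Fin; zero; suc; punchIn; punchOut; _≟_)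
open import Data.Fin.Properties using (punchIn-punchOut; punchOut-punchIn; punchOut-cong; punchIn-injective; punchInᵢ≢i)
open import Data.Product using (_×_; _,_; proj₁; proj₂; ∃-syntax)
open import Data.Product.Properties using (≡-dec)
open import Data.Sum using (_⊎_; inj₁; inj₂)
open import Data.List using (List; map; length; deduplicate)
open import Data.List.Properties using (length-map; length-deduplicate)
open import Data.List.Membership.Propositional using (_∈_)
open import Data.List.Membership.Propositional.Properties using (∈-map⁺; ∈-deduplicate⁺)
open import Data.List.Relation.Unary.Unique.DecPropositional.Properties using (deduplicate-!)
import Data.List.Relation.Unary.Unique.Propositional.Properties as Unique
open import Function using (_∘_; _$_)
open import Function.Bundles using (_⇔_; mk⇔; Equivalence; _↔_; mk↔ₛ′; Inverse)
open import Relation.Binary.Definitions using (DecidableEquality)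
open import Relation.Binary.PropositionalEquality
  using (_≡_; _≢_; refl; sym; trans; cong; cong₂; subst; module ≡-Reasoning)
open import Relation.Nullary using (yes; no; contradiction)
import Algebra.Properties.CommutativeSemigroup +-commutativeSemigroup as +-CS

private variable
  a b c a' b' c' n : ℕ

≡⇒eqInd≡1 : {x y : Fin n} → x ≡ y → eqInd x y ≡ 1
≡⇒eqInd≡1 {x = x} {y} x≡y with x ≟ y
... | yes _   = refl
... | no x≢y  = contradiction x≡y x≢y

≢⇒eqInd≡0 : {x y : Fin n} → x ≢ y → eqInd x y ≡ 0
≢⇒eqInd≡0 {x = x} {y} x≢y with x ≟ y
... | yes x≡y = contradiction x≡y x≢y
... | no _    = refl

eqInd-cong : {x y : Fin a} {x' y' : Fin b} → (x ≡ y ⇔ x' ≡ y') → eqInd x y ≡ eqInd x' y'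
eqInd-cong {x = x} {y} x≡y⇔x'≡y' with x ≟ y
... | yes x≡y = sym (≡⇒eqInd≡1 (Equivalence.to x≡y⇔x'≡y' x≡y))
... | no x≢y  = sym (≢⇒eqInd≡0 (x≢y ∘ Equivalence.from x≡y⇔x'≡y'))

eqInd-punchOut : {j y : Fin (suc n)} (j≢y : j ≢ y) (t : Fin n) →
                 eqInd t (punchOut j≢y) ≡ eqInd (punchIn j t) y
eqInd-punchOut {j = j} j≢y t = eqInd-cong (mk⇔
  (λ t≡ → trans (cong (punchIn j) t≡) (punchIn-punchOut j≢y))
  (λ ≡y → trans (sym (punchOut-punchIn j)) (punchOut-cong j ≡y)))

Distinguished : List (Triple a b c) → Triple a b c → Triple a b c → Set
Distinguished L s s' = ∃[ q ] (q ∈ L × g s q ≢ g s' q)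

-- Feasible Q is Resolving (questions Q) by definition; merged question lists may
-- contain duplicates, so they are not strategies.
Resolving : List (Triple a b c) → Set
Resolving {a} {b} {c} L = (s s' : Triple a b c) → s ≢ s' → Distinguished L s s'

Distinguished-sym : {L : List (Triple a b c)} {s s' : Triple a b c} →
                    Distinguished L s s' → Distinguished L s' s
Distinguished-sym (q , q∈L , gs≢gs') = q , q∈L , gs≢gs' ∘ sym

Distinguished-map : {L : List (Triple a b c)} {s s' : Triple a b c} {t t' : Triple a' b' c'}
                    (f : Triple a b c → Triple a' b' c') →
                    (∀ q → g s q ≢ g s' q → g t (f q) ≢ g t' (f q)) →
                    Distinguished L s s' → Distinguished (map f L) t t'
Distinguished-map f transfer (q , q∈L , gs≢gs') = f q , ∈-map⁺ f q∈L , transfer q gs≢gs'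

_≟ₜ_ : DecidableEquality (Triple a b c)
_≟ₜ_ = ≡-dec _≟_ (≡-dec _≟_ _≟_)

Resolving⇒FBoundedBy : {L : List (Triple a b c)} → Resolving L → length L ≤ n → FBoundedBy a b c n
Resolving⇒FBoundedBy {L = L} resolving |L|≤n =
  strategy (deduplicate _≟ₜ_ L) (deduplicate-! _≟ₜ_ L) ,
  (λ s s' s≢s' → let q , q∈L , d = resolving s s' s≢s' in q , ∈-deduplicate⁺ _≟ₜ_ q∈L , d) ,
  ≤-trans (length-deduplicate _≟ₜ_ L) |L|≤n

module _ (σ : Triple a b c ↔ Triple a' b' c')
         (g-σ : ∀ s q → g (Inverse.to σ s) (Inverse.to σ q) ≡ g s q) where
  open Inverse σ

  Resolving-map : {L : List (Triple a b c)} → Resolving L → Resolving (map to L)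
  Resolving-map resolving t t' t≢t' =
    Distinguished-map {s = from t} {from t'} {t} {t'} to transfer (resolving (from t) (from t') (t≢t' ∘ from-injective))
    where
    from-injective : from t ≡ from t' → t ≡ t'
    from-injective e = trans (sym (strictlyInverseˡ t)) (trans (cong to e) (strictlyInverseˡ t'))

    g-to : ∀ u q → g u (to q) ≡ g (from u) q
    g-to u q = trans (cong (λ v → g v (to q)) (sym (strictlyInverseˡ u))) (g-σ (from u) q)

    transfer : ∀ q → g (from t) q ≢ g (from t') q → g t (to q) ≢ g t' (to q)
    transfer q d e = d (trans (sym (g-to t q)) (trans e (g-to t' q)))

  FBoundedBy-permute : FBoundedBy a b c n → FBoundedBy a' b' c' n
  FBoundedBy-permute (Q , feasible , |Q|≤n) =
    strategy (map to (questions Q)) (Unique.map⁺ to-injective (unique Q)) ,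
    Resolving-map feasible ,
    ≤-trans (≤-reflexive (length-map to (questions Q))) |Q|≤n
    where
    to-injective : ∀ {s s'} → to s ≡ to s' → s ≡ s'
    to-injective {s} {s'} e = trans (sym (strictlyInverseʳ s)) (trans (cong from e) (strictlyInverseʳ s'))

swap₁₂ : Triple a b c ↔ Triple b a c
swap₁₂ = mk↔ₛ′ (λ (x , y , z) → y , x , z) (λ (y , x , z) → x , y , z) (λ _ → refl) (λ _ → refl)

swap₁₃ : Triple a b c ↔ Triple c b a
swap₁₃ = mk↔ₛ′ (λ (x , y , z) → z , y , x) (λ (z , y , x) → x , y , z) (λ _ → refl) (λ _ → refl)

g-swap₁₂ : (s q : Triple a b c) → g (Inverse.to swap₁₂ s) (Inverse.to swap₁₂ q) ≡ g s q
g-swap₁₂ (x , y , z) (x' , y' , z') = +-CS.xy∙z≈yx∙z (eqInd y y') (eqInd x x') (eqInd z z')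

g-swap₁₃ : (s q : Triple a b c) → g (Inverse.to swap₁₃ s) (Inverse.to swap₁₃ q) ≡ g s q
g-swap₁₃ (x , y , z) (x' , y' , z') = +-CS.xy∙z≈zy∙x (eqInd z z') (eqInd y y') (eqInd x x')

g-≡-first-peg-irrelevant : {x x' : Fin a} {y y' : Fin a'} (r r' ρ : Fin b × Fin c) →
                           g (x , r) (x' , ρ) ≡ g (x , r') (x' , ρ) →
                           g (y , r) (y' , ρ) ≡ g (y , r') (y' , ρ)
g-≡-first-peg-irrelevant {x = x} {x'} {y} {y'} (r₂ , r₃) (r₂' , r₃') (ρ₂ , ρ₃) e = begin
  eqInd y y' + eqInd r₂ ρ₂ + eqInd r₃ ρ₃     ≡⟨ +-assoc (eqInd y y') _ _ ⟩
  eqInd y y' + (eqInd r₂ ρ₂ + eqInd r₃ ρ₃)   ≡⟨ cong (eqInd y y' +_) rest-equal ⟩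
  eqInd y y' + (eqInd r₂' ρ₂ + eqInd r₃' ρ₃) ≡⟨ +-assoc (eqInd y y') _ _ ⟨
  eqInd y y' + eqInd r₂' ρ₂ + eqInd r₃' ρ₃   ∎
  where
  open ≡-Reasoning
  rest-equal : eqInd r₂ ρ₂ + eqInd r₃ ρ₃ ≡ eqInd r₂' ρ₂ + eqInd r₃' ρ₃
  rest-equal = +-cancelˡ-≡ (eqInd x x') _ _
    (trans (sym (+-assoc (eqInd x x') _ _)) (trans e (+-assoc (eqInd x x') _ _)))

Mergeable₁ : List (Triple a b c) → Fin a → Fin a → Set
Mergeable₁ {a} {b} {c} L i j = (y : Fin b) (z : Fin c) →
  ∃[ q₁ ] ∃[ q₂ ] ∃[ q₃ ] ((q₁ , q₂ , q₃) ∈ L × (q₁ ≡ i ⊎ q₁ ≡ j) × q₂ ≢ y × q₃ ≢ z)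

module Merge {m : ℕ} {i j : Fin (suc (suc m))} (i≢j : i ≢ j) where

  merge : Fin (suc (suc m)) → Fin (suc m)
  merge x with x ≟ j
  ... | yes _   = punchOut (i≢j ∘ sym)
  ... | no x≢j  = punchOut (x≢j ∘ sym)

  merge-j≡merge-i : merge j ≡ merge i
  merge-j≡merge-i with j ≟ j | i ≟ j
  ... | yes _   | no _    = punchOut-cong j refl
  ... | _       | yes i≡j = contradiction i≡j i≢j
  ... | no j≢j  | _       = contradiction refl j≢j

  eqInd-merge-≢j : (v : Fin (suc m)) {x : Fin (suc (suc m))} → x ≢ j →
                   eqInd v (merge x) ≡ eqInd (punchIn j v) x
  eqInd-merge-≢j v {x} x≢j with x ≟ j
  ... | yes x≡j = contradiction x≡j x≢j
  ... | no _    = eqInd-punchOut _ v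

  merged-color : {x : Fin (suc (suc m))} → x ≡ i ⊎ x ≡ j → merge x ≡ merge i
  merged-color (inj₁ refl) = refl
  merged-color (inj₂ refl) = merge-j≡merge-i

  eqInd-merge-outside : (v : Fin (suc m)) (x : Fin (suc (suc m))) → punchIn j v ≢ i →
                        eqInd v (merge x) ≡ eqInd (punchIn j v) x
  eqInd-merge-outside v x ιv≢i with x ≟ j
  ... | no _     = eqInd-punchOut _ v
  ... | yes refl = trans (eqInd-punchOut _ v)
                     (trans (≢⇒eqInd≡0 ιv≢i) (sym (≢⇒eqInd≡0 (punchInᵢ≢i j v))))

  eqInd-merge-onto : (v : Fin (suc m)) {x : Fin (suc (suc m))} → punchIn j v ≡ i →
                     x ≡ i ⊎ x ≡ j → eqInd v (merge x) ≡ 1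
  eqInd-merge-onto v {x} ιv≡i x∈ij = begin
    eqInd v (merge x)      ≡⟨ cong (eqInd v) (merged-color x∈ij) ⟩
    eqInd v (merge i)      ≡⟨ eqInd-merge-≢j v i≢j ⟩
    eqInd (punchIn j v) i  ≡⟨ ≡⇒eqInd≡1 ιv≡i ⟩
    1                      ∎
    where open ≡-Reasoning

  eqInd-merge-off : (v : Fin (suc m)) {x : Fin (suc (suc m))} → punchIn j v ≢ i →
                    x ≡ i ⊎ x ≡ j → eqInd v (merge x) ≡ 0
  eqInd-merge-off v {x} ιv≢i x∈ij =
    trans (eqInd-merge-outside v x ιv≢i) (≢⇒eqInd≡0 (ιv≢x x∈ij))
    where
    ιv≢x : x ≡ i ⊎ x ≡ j → punchIn j v ≢ x
    ιv≢x (inj₁ refl) = ιv≢i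
    ιv≢x (inj₂ refl) = punchInᵢ≢i j v

  embed : Triple (suc m) b c → Triple (suc (suc m)) b c
  embed (v , r) = punchIn j v , r

  embed-injective : {t t' : Triple (suc m) b c} → embed t ≡ embed t' → t ≡ t'
  embed-injective {t = v , r} {v' , r'} e =
    cong₂ _,_ (punchIn-injective j v v' (cong proj₁ e)) (cong proj₂ e)

  mergeQuestion : Triple (suc (suc m)) b c → Triple (suc m) b c
  mergeQuestion (x , ρ) = merge x , ρ

  g-merge-outside : (t : Triple (suc m) b c) (q : Triple (suc (suc m)) b c) →
                    punchIn j (proj₁ t) ≢ i → g t (mergeQuestion q) ≡ g (embed t) q
  g-merge-outside (v , y , z) (x , y' , z') ιv≢i =
    cong (λ k → k + eqInd y y' + eqInd z z') (eqInd-merge-outside v x ιv≢i)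

  separated : {L : List (Triple (suc (suc m)) b c)} → Mergeable₁ L i j →
              (t t' : Triple (suc m) b c) → punchIn j (proj₁ t) ≡ i → punchIn j (proj₁ t') ≢ i →
              Distinguished (map mergeQuestion L) t t'
  separated mergeable (v , y , z) (v' , y' , z') ιv≡i ιv'≢i
    with mergeable y' z'
  ... | q₁ , q₂ , q₃ , q∈L , q₁∈ij , q₂≢y' , q₃≢z' =
    mergeQuestion (q₁ , q₂ , q₃) , ∈-map⁺ mergeQuestion q∈L ,
    λ e → 1+n≢0 (trans (sym positive) (trans e vanishing))
    where
    positive : g (v , y , z) (merge q₁ , q₂ , q₃) ≡ 1 + eqInd y q₂ + eqInd z q₃
    positive = cong (λ k → k + eqInd y q₂ + eqInd z q₃) (eqInd-merge-onto v ιv≡i q₁∈ij)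

    vanishing : g (v' , y' , z') (merge q₁ , q₂ , q₃) ≡ 0
    vanishing = cong₂ _+_ (cong₂ _+_ (eqInd-merge-off v' ιv'≢i q₁∈ij) (≢⇒eqInd≡0 (q₂≢y' ∘ sym)))
                          (≢⇒eqInd≡0 (q₃≢z' ∘ sym))

  merge-resolving : {L : List (Triple (suc (suc m)) b c)} → Resolving L → Mergeable₁ L i j →
                    Resolving (map mergeQuestion L)
  merge-resolving resolving mergeable t@(v , r) t'@(v' , r') t≢t'
    with v ≟ v' | punchIn j v ≟ i | punchIn j v' ≟ i
  ... | yes refl | _ | _ =
    Distinguished-map {s = embed t} {embed t'} {t} {t'} mergeQuestion
      (λ _ d → d ∘ g-≡-first-peg-irrelevant r r' _)
      (resolving (embed t) (embed t') (t≢t' ∘ embed-injective))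
  ... | no v≢v' | yes ιv≡i | yes ιv'≡i =
    contradiction (punchIn-injective j v v' (trans ιv≡i (sym ιv'≡i))) v≢v'
  ... | no _ | yes ιv≡i | no ιv'≢i = separated mergeable t t' ιv≡i ιv'≢i
  ... | no _ | no ιv≢i | yes ιv'≡i = Distinguished-sym {s = t'} {t} (separated mergeable t' t ιv'≡i ιv≢i)
  ... | no _ | no ιv≢i | no ιv'≢i =
    Distinguished-map {s = embed t} {embed t'} {t} {t'} mergeQuestion
      (λ q d e → d (trans (sym (g-merge-outside t q ιv≢i)) (trans e (g-merge-outside t' q ιv'≢i))))
      (resolving (embed t) (embed t') (t≢t' ∘ embed-injective))

merge-first-peg : (L : List (Triple a b c)) → Resolving L → {i j : Fin a} → i ≢ j →
                  Mergeable₁ L i j → FBoundedBy (a ∸ 1) b c (length L)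
merge-first-peg {suc zero}    L _ {zero} {zero} i≢j _ = contradiction refl i≢j
merge-first-peg {suc (suc m)} L resolving i≢j mergeable =
  Resolving⇒FBoundedBy (merge-resolving resolving mergeable) (≤-reflexive (length-map mergeQuestion L))
  where open Merge i≢j

Mergeable₂ : List (Triple a b c) → Fin b → Fin b → Set
Mergeable₂ {a} {b} {c} L i j = (x : Fin a) (z : Fin c) →
  ∃[ q₁ ] ∃[ q₂ ] ∃[ q₃ ] ((q₁ , q₂ , q₃) ∈ L × (q₂ ≡ i ⊎ q₂ ≡ j) × q₁ ≢ x × q₃ ≢ z)

Mergeable₃ : List (Triple a b c) → Fin c → Fin c → Set
Mergeable₃ {a} {b} {c} L i j = (x : Fin a) (y : Fin b) →
  ∃[ q₁ ] ∃[ q₂ ] ∃[ q₃ ] ((q₁ , q₂ , q₃) ∈ L × (q₃ ≡ i ⊎ q₃ ≡ j) × q₁ ≢ x × q₂ ≢ y)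

Mergeable₂⇒Mergeable₁-swap₁₂ : {L : List (Triple a b c)} {i j : Fin b} →
  Mergeable₂ L i j → Mergeable₁ (map (Inverse.to swap₁₂) L) i j
Mergeable₂⇒Mergeable₁-swap₁₂ mergeable x z =
  let q₁ , q₂ , q₃ , q∈L , q₂∈ij , q₁≢x , q₃≢z = mergeable x z
  in q₂ , q₁ , q₃ , ∈-map⁺ (Inverse.to swap₁₂) q∈L , q₂∈ij , q₁≢x , q₃≢z

Mergeable₃⇒Mergeable₁-swap₁₃ : {L : List (Triple a b c)} {i j : Fin c} →
  Mergeable₃ L i j → Mergeable₁ (map (Inverse.to swap₁₃) L) i j
Mergeable₃⇒Mergeable₁-swap₁₃ mergeable y x =
  let q₁ , q₂ , q₃ , q∈L , q₃∈ij , q₁≢x , q₂≢y = mergeable x y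
  in q₃ , q₂ , q₁ , ∈-map⁺ (Inverse.to swap₁₃) q∈L , q₃∈ij , q₂≢y , q₁≢x

merge-second-peg : (L : List (Triple a b c)) → Resolving L → {i j : Fin b} → i ≢ j →
                   Mergeable₂ L i j → FBoundedBy a (b ∸ 1) c (length L)
merge-second-peg L resolving i≢j mergeable =
  subst (FBoundedBy _ _ _) (length-map (Inverse.to swap₁₂) L) $
  FBoundedBy-permute swap₁₂ g-swap₁₂ $
  merge-first-peg (map (Inverse.to swap₁₂) L) (Resolving-map swap₁₂ g-swap₁₂ resolving) i≢j
    (Mergeable₂⇒Mergeable₁-swap₁₂ mergeable)

merge-third-peg : (L : List (Triple a b c)) → Resolving L → {i j : Fin c} → i ≢ j →
                  Mergeable₃ L i j → FBoundedBy a b (c ∸ 1) (length L)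
merge-third-peg L resolving i≢j mergeable =
  subst (FBoundedBy _ _ _) (length-map (Inverse.to swap₁₃) L) $
  FBoundedBy-permute swap₁₃ g-swap₁₃ $
  merge-first-peg (map (Inverse.to swap₁₃) L) (Resolving-map swap₁₃ g-swap₁₃ resolving) i≢j
    (Mergeable₃⇒Mergeable₁-swap₁₃ mergeable)

corollary2 :
    ((a b c : ℕ) → 2 ≤ a → (Q : Strategy a b c) → Optimal Q →
      (i j : Fin a) → i ≢ j →
      ((y : Fin b) (z : Fin c) →
        ∃[ q₁ ] ∃[ q₂ ] ∃[ q₃ ] ((q₁ , q₂ , q₃) ∈ questions Q ×
          (q₁ ≡ i ⊎ q₁ ≡ j) × q₂ ≢ y × q₃ ≢ z)) →
      FBoundedBy (a ∸ 1) b c (card Q))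
    ×
    ((a b c : ℕ) → 2 ≤ a → (Q : Strategy a b c) → Optimal Q →
      (i j : Fin b) → i ≢ j →
      ((x : Fin a) (z : Fin c) →
        ∃[ q₁ ] ∃[ q₂ ] ∃[ q₃ ] ((q₁ , q₂ , q₃) ∈ questions Q ×
          (q₂ ≡ i ⊎ q₂ ≡ j) × q₁ ≢ x × q₃ ≢ z)) →
      FBoundedBy a (b ∸ 1) c (card Q))
    ×
    ((a b c : ℕ) → 2 ≤ a → (Q : Strategy a b c) → Optimal Q →
      (i j : Fin c) → i ≢ j →
      ((x : Fin a) (y : Fin b) →
        ∃[ q₁ ] ∃[ q₂ ] ∃[ q₃ ] ((q₁ , q₂ , q₃) ∈ questions Q ×
          (q₃ ≡ i ⊎ q₃ ≡ j) × q₁ ≢ x × q₂ ≢ y)) →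
      FBoundedBy a b (c ∸ 1) (card Q))
corollary2 =
    (λ _ _ _ _ Q optimal _ _ → merge-first-peg (questions Q) (proj₁ optimal))
  , (λ _ _ _ _ Q optimal _ _ → merge-second-peg (questions Q) (proj₁ optimal))
  , (λ _ _ _ _ Q optimal _ _ → merge-third-peg (questions Q) (proj₁ optimal))
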